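{- Fix any field $\mathbb{F}$ and integers $r\le k$. Let $G$ be a directed graph on vertex set $\{1,\ldots,n\}$. Then $G$ contains an $r$-simple path of length $k$ if and only if the polynomial $$P_G(\mathbf{x},\mathbf{y})=\sum_{i_1\to i_2\to\cdots\to i_k\in G} x_{i_1}\cdots x_{i_k}\, y_{1,i_1}\cdots y_{k,i_k},$$ viewed as a polynomial in $\mathbf{x}=(x_1,\ldots,x_n)$ with coefficients in the field of rational functions $\mathbb{F}(\mathbf{y})$, contains an $r$-monomial.
   Context: A path of length $k$ in a directed graph $G$ is a sequence of vertices $i_1,\ldots,i_k$ with $(i_j,i_{j+1})$ an edge for all $j<k$ (vertices may repeat); the sum above is over all such paths, written $i_1\to\cdots\to i_k\in G$. A path is $r$-simple if each vertex appears in it at most $r$ times. Here $x_1,\ldots,x_n$ and $y_{m,i}$ ($1\le m\le k$, $1\le i\le n$) are indeterminates. A monomial $z_1^{a_1}\cdots z_t^{a_t}$ is an $r$-monomial if $a_j\le r$ for all $j$; a polynomial contains an $r$-monomial if some $r$-monomial appears in it with nonzero coefficient. -}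

module Defs where

open import Level using (Level; _⊔_; suc)
open import Algebra.Bundles using (CommutativeRing)
open import Data.Nat using (ℕ; zero; suc; _≤_)
open import Data.Bool using (Bool; true; false; _∧_; if_then_else_)
open import Data.Fin using (Fin)
open import Data.Fin.Properties using () renaming (_≟_ to _≟ᶠ_)
open import Data.Vec using (Vec; []; _∷_; lookup; tabulate; count)
open import Data.Vec.Properties using (≡-dec)
open import Data.List using (List; []; _∷_; map; concatMap; filter; allFin; foldr)
open import Data.Product using (_×_; _,_; ∃; proj₁; proj₂)
open import Data.Product.Properties using () renaming (≡-dec to ×-≡-dec)
open import Data.Nat.Properties using () renaming (_≟_ to _≟ℕ_)
open import Relation.Nullary using (¬_; does)
open import Relation.Binary.PropositionalEquality using (_≡_)
open import Relation.Binary.Definitions using (DecidableEquality)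
open import Data.Bool using (T)
open import Data.Bool.Properties using (T?)

record Field (c ℓ : Level) : Set (Level.suc (c ⊔ ℓ)) where
  field
    commutativeRing : CommutativeRing c ℓ
  open CommutativeRing commutativeRing public
  field
    0≉1     : ¬ (0# ≈ 1#)
    inverse : ∀ x → ¬ (x ≈ 0#) → ∃ λ y → (x * y) ≈ 1#

Graph : ℕ → Set
Graph n = Fin n → Fin n → Bool

-- A sequence of k vertices i₁,…,i_k is a path in G iff every
-- consecutive pair (i_j , i_{j+1}) is an edge. Vertices may repeat.
isPathᵇ : ∀ {n k} → Graph n → Vec (Fin n) k → Bool
isPathᵇ G []           = true
isPathᵇ G (i ∷ [])     = true
isPathᵇ G (i ∷ j ∷ is) = G i j ∧ isPathᵇ G (j ∷ is)

IsPath : ∀ {n k} → Graph n → Vec (Fin n) k → Set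
IsPath G p = T (isPathᵇ G p)

occ : ∀ {n k} → Fin n → Vec (Fin n) k → ℕ
occ v p = count (v ≟ᶠ_) p

RSimple : ∀ {n k} → ℕ → Vec (Fin n) k → Set
RSimple r p = ∀ v → occ v p ≤ r

HasRSimplePath : ∀ {n} → Graph n → ℕ → ℕ → Set
HasRSimplePath {n} G r k = ∃ λ (p : Vec (Fin n) k) → IsPath G p × RSimple r p

allSeqs : ∀ n k → List (Vec (Fin n) k)
allSeqs n zero    = [] ∷ []
allSeqs n (suc k) = concatMap (λ i → map (i ∷_) (allSeqs n k)) (allFin n)

-- Monomials in the indeterminates x₁,…,x_n and y_{m,i} (1≤m≤k, 1≤i≤n),
-- given by exponent vectors: (a , b) stands for
--   ∏_i x_i^{a_i} · ∏_{m,i} y_{m,i}^{b_{m,i}}.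

XExp : ℕ → Set
XExp n = Vec ℕ n

YExp : ℕ → ℕ → Set
YExp n k = Vec (Vec ℕ n) k

Mon : ℕ → ℕ → Set
Mon n k = XExp n × YExp n k

_≟Mon_ : ∀ {n k} → DecidableEquality (Mon n k)
_≟Mon_ = ×-≡-dec (≡-dec _≟ℕ_) (≡-dec (≡-dec _≟ℕ_))

-- The monomial x_{i₁}⋯x_{i_k} · y_{1,i₁}⋯y_{k,i_k} of a sequence.
pathMon : ∀ {n k} → Vec (Fin n) k → Mon n k
pathMon {n} {k} p =
    tabulate (λ v → occ v p)
  , tabulate (λ m → tabulate (λ v → if does (v ≟ᶠ lookup p m) then 1 else 0))

-- Polynomials over a field F in the variables x, y, written as formal
-- sums (lists) of terms c·(monomial); the coefficient of a monomial is
-- the sum of the coefficients of the terms carrying that monomial.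

module Poly {c ℓ} (F : Field c ℓ) where
  open Field F

  Polynomial : ℕ → ℕ → Set c
  Polynomial n k = List (Carrier × Mon n k)

  coeff : ∀ {n k} → Polynomial n k → Mon n k → Carrier
  coeff P μ = foldr (λ t acc → (if does (proj₂ t ≟Mon μ) then proj₁ t else 0#) + acc) 0# P

  P[_] : ∀ {n} → Graph n → (k : ℕ) → Polynomial n k
  P[_] {n} G k = map (λ p → (1# , pathMon p)) (filter (λ p → T? (isPathᵇ G p)) (allSeqs n k))

  -- Viewing P as a polynomial in x with coefficients in F(y) ⊇ F[y]:
  -- the coefficient of x^a is the polynomial in y whose coefficient at
  -- y^b is coeff P (a , b).
  xCoeff : ∀ {n k} → Polynomial n k → XExp n → (YExp n k → Carrier)
  xCoeff P a b = coeff P (a , b)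

  NonZeroY : ∀ {n k} → (YExp n k → Carrier) → Set ℓ
  NonZeroY {n} {k} f = ∃ λ (b : YExp n k) → ¬ (f b ≈ 0#)

  IsRMonomial : ∀ {n} → ℕ → XExp n → Set
  IsRMonomial {n} r a = ∀ (i : Fin n) → lookup a i ≤ r

  ContainsRMonomial : ∀ {n k} → ℕ → Polynomial n k → Set ℓ
  ContainsRMonomial {n} r P =
    ∃ λ (a : XExp n) → IsRMonomial r a × NonZeroY (xCoeff P a)

-- The terms of P_G are indexed by the paths of G, and the monomial of a path determines the
-- path, since its y-part records which vertex sits at each position. Hence P_G is a sum of
-- distinct monomials, each with coefficient 1: P_G contains the x-monomial of a path, and
-- nothing else. The x-monomial of a path counts the occurrences of each vertex, so it is an
-- r-monomial exactly when the path is r-simple.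
module Submission where

open import Defs
open import Level using (Level)
open import Data.Nat using (ℕ; zero; suc; _≤_)
open import Function using (_∘_)
open import Function.Bundles using (_⇔_; mk⇔; module Equivalence)
open import Data.Bool using (Bool; if_then_else_)
open import Data.Bool.Properties using (T?)
open import Data.Fin using (Fin)
open import Data.Fin.Properties using (_≟_)
open import Data.Vec using (Vec; []; _∷_; lookup; tabulate)
open import Data.Vec.Properties using (lookup∘tabulate; tabulate∘lookup; tabulate-cong; ∷-injectiveˡ; ∷-injectiveʳ)
open import Data.List using (List; []; _∷_; map; filter)
open import Data.List.Properties using (map-∘)
open import Data.List.Relation.Unary.Any using (here; there; any?)
import Data.List.Relation.Unary.All as All
import Data.List.Relation.Unary.All.Properties as All
import Data.List.Relation.Unary.AllPairs as AllPairs
import Data.List.Relation.Unary.AllPairs.Properties as AllPairs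
open import Data.List.Membership.Propositional using (_∈_; _∉_)
open import Data.List.Membership.Propositional.Properties using (∈-allFin; ∈-map⁺; ∈-map⁻; ∈-concat⁺′; ∈-filter⁺; ∈-filter⁻)
open import Data.List.Relation.Binary.Disjoint.Propositional using (Disjoint)
open import Data.List.Relation.Unary.Unique.Propositional using (Unique; []; _∷_)
open import Data.List.Relation.Unary.Unique.Propositional.Properties using (allFin⁺; map⁺; concat⁺; filter⁺)
open import Data.Product using (∃; _×_; _,_; proj₁; proj₂)
open import Relation.Nullary using (¬_; Dec; does; yes; no)
open import Relation.Nullary.Decidable using (dec-true; decidable-stable)
open import Relation.Nullary.Negation using (contradiction)
open import Relation.Binary.PropositionalEquality using (_≡_; _≢_; refl; sym; trans; cong; subst; module ≡-Reasoning)

allSeqs-complete : ∀ {n k} (p : Vec (Fin n) k) → p ∈ allSeqs n k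
allSeqs-complete []      = here refl
allSeqs-complete (i ∷ p) = ∈-concat⁺′ (∈-map⁺ (i ∷_) (allSeqs-complete p)) (∈-map⁺ _ (∈-allFin i))

map-∷-disjoint : ∀ {n k} {i j : Fin n} {ps qs : List (Vec (Fin n) k)} →
                 i ≢ j → Disjoint (map (i ∷_) ps) (map (j ∷_) qs)
map-∷-disjoint i≢j (v∈ , v∈′) with ∈-map⁻ _ v∈ | ∈-map⁻ _ v∈′
... | _ , _ , refl | _ , _ , eq = i≢j (∷-injectiveˡ eq)

allSeqs-unique : ∀ n k → Unique (allSeqs n k)
allSeqs-unique n zero    = All.[] ∷ []
allSeqs-unique n (suc k) =
  concat⁺ (All.map⁺ (All.tabulate λ _ → map⁺ ∷-injectiveʳ (allSeqs-unique n k)))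
          (AllPairs.map⁺ (AllPairs.map map-∷-disjoint (allFin⁺ n)))

paths : ∀ {n} → Graph n → (k : ℕ) → List (Vec (Fin n) k)
paths {n} G k = filter (λ p → T? (isPathᵇ G p)) (allSeqs n k)

∈-paths⁺ : ∀ {n k} {G : Graph n} (p : Vec (Fin n) k) → IsPath G p → p ∈ paths G k
∈-paths⁺ {G = G} p = ∈-filter⁺ (λ q → T? (isPathᵇ G q)) (allSeqs-complete p)

∈-paths⁻ : ∀ {n k} {G : Graph n} {p : Vec (Fin n) k} → p ∈ paths G k → IsPath G p
∈-paths⁻ {n} {k} {G} = proj₂ ∘ ∈-filter⁻ (λ q → T? (isPathᵇ G q)) {xs = allSeqs n k}

paths-unique : ∀ {n} (G : Graph n) k → Unique (paths G k)
paths-unique {n} G k = filter⁺ (λ q → T? (isPathᵇ G q)) (allSeqs-unique n k)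

indicator : Bool → ℕ
indicator b = if b then 1 else 0

indicator-does≡1 : ∀ {a} {A : Set a} (A? : Dec A) → indicator (does A?) ≡ 1 → A
indicator-does≡1 (yes a) _ = a

lookup-xExp : ∀ {n k} (p : Vec (Fin n) k) v → lookup (proj₁ (pathMon p)) v ≡ occ v p
lookup-xExp p = lookup∘tabulate (λ v → occ v p)

lookup-yExp : ∀ {n k} (p : Vec (Fin n) k) m v →
              lookup (lookup (proj₂ (pathMon p)) m) v ≡ indicator (does (v ≟ lookup p m))
lookup-yExp p m v = trans (cong (λ row → lookup row v) (lookup∘tabulate _ m)) (lookup∘tabulate _ v)

pathMon-injective : ∀ {n k} {p q : Vec (Fin n) k} → pathMon p ≡ pathMon q → p ≡ q
pathMon-injective {p = p} {q} eq = begin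
  p                      ≡⟨ sym (tabulate∘lookup p) ⟩
  tabulate (lookup p)    ≡⟨ tabulate-cong lookup-agrees ⟩
  tabulate (lookup q)    ≡⟨ tabulate∘lookup q ⟩
  q                      ∎
  where
  open ≡-Reasoning
  lookup-agrees : ∀ m → lookup p m ≡ lookup q m
  lookup-agrees m = indicator-does≡1 (v ≟ lookup q m) (begin
    indicator (does (v ≟ lookup q m))           ≡⟨ sym (lookup-yExp q m v) ⟩
    lookup (lookup (proj₂ (pathMon q)) m) v     ≡⟨ cong (λ μ → lookup (lookup (proj₂ μ) m) v) (sym eq) ⟩
    lookup (lookup (proj₂ (pathMon p)) m) v     ≡⟨ lookup-yExp p m v ⟩
    indicator (does (v ≟ v))                    ≡⟨ cong indicator (dec-true (v ≟ v) refl) ⟩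
    1                                           ∎)
    where v = lookup p m

module _ {c ℓ} (F : Field c ℓ) where
  open Field F using (Carrier; _≈_; 0#; 1#; +-identityˡ; +-identityʳ; +-congˡ)
    renaming (refl to ≈-refl; trans to ≈-trans)
  open Poly F

  coeff-map-∉ : ∀ {n k} (a : Carrier) {μ : Mon n k} {ms} → μ ∉ ms → coeff (map (a ,_) ms) μ ≈ 0#
  coeff-map-∉ a {ms = []}     μ∉ = ≈-refl
  coeff-map-∉ a {μ} {ν ∷ ms} μ∉ with ν ≟Mon μ
  ... | yes ν≡μ = contradiction (here (sym ν≡μ)) μ∉
  ... | no  _   = ≈-trans (+-identityˡ _) (coeff-map-∉ a (μ∉ ∘ there))

  coeff-map-∈ : ∀ {n k} (a : Carrier) {μ : Mon n k} {ms} → Unique ms → μ ∈ ms → coeff (map (a ,_) ms) μ ≈ a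
  coeff-map-∈ a {μ} (μ∉ ∷ _) (here refl) with μ ≟Mon μ
  ... | yes _   = ≈-trans (+-congˡ (coeff-map-∉ a (λ μ∈ → All.lookup μ∉ μ∈ refl))) (+-identityʳ a)
  ... | no  μ≢μ = contradiction refl μ≢μ
  coeff-map-∈ a {μ} {ν ∷ _} (ν∉ ∷ u) (there μ∈) with ν ≟Mon μ
  ... | yes ν≡μ = contradiction ν≡μ (All.lookup ν∉ μ∈)
  ... | no  _   = ≈-trans (+-identityˡ _) (coeff-map-∈ a u μ∈)

  P≡sum-of-path-monomials : ∀ {n} (G : Graph n) k → P[ G ] k ≡ map (1# ,_) (map pathMon (paths G k))
  P≡sum-of-path-monomials G k = map-∘ (paths G k)

  coeff-P-pathMon : ∀ {n k} (G : Graph n) (p : Vec (Fin n) k) → IsPath G p → coeff (P[ G ] k) (pathMon p) ≈ 1#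
  coeff-P-pathMon {k = k} G p path =
    subst (λ P → coeff P (pathMon p) ≈ 1#) (sym (P≡sum-of-path-monomials G k))
      (coeff-map-∈ 1# (map⁺ pathMon-injective (paths-unique G k)) (∈-map⁺ pathMon (∈-paths⁺ p path)))

  coeff-P≉0⇒pathMon : ∀ {n k} (G : Graph n) {μ : Mon n k} → ¬ (coeff (P[ G ] k) μ ≈ 0#) →
                      ∃ λ p → IsPath G p × μ ≡ pathMon p
  coeff-P≉0⇒pathMon {k = k} G {μ} coeff≉0 =
    let p , p∈paths , μ≡p = ∈-map⁻ pathMon μ∈ in p , ∈-paths⁻ p∈paths , μ≡p
    where
    coeff-P≈0 : μ ∉ map pathMon (paths G k) → coeff (P[ G ] k) μ ≈ 0#
    coeff-P≈0 μ∉ = subst (λ P → coeff P μ ≈ 0#) (sym (P≡sum-of-path-monomials G k)) (coeff-map-∉ 1# μ∉)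
    μ∈ : μ ∈ map pathMon (paths G k)
    μ∈ = decidable-stable (any? (μ ≟Mon_) _) (coeff≉0 ∘ coeff-P≈0)

  rMonomial⇔rSimple : ∀ {n k} r (p : Vec (Fin n) k) → IsRMonomial r (proj₁ (pathMon p)) ⇔ RSimple r p
  rMonomial⇔rSimple r p = mk⇔
    (λ rmon v → subst (_≤ r) (lookup-xExp p v) (rmon v))
    (λ simple v → subst (_≤ r) (sym (lookup-xExp p v)) (simple v))

lemma2 : ∀ {c ℓ : Level} (F : Field c ℓ) (r k n : ℕ) → r ≤ k → (G : Graph n) → HasRSimplePath G r k ⇔ Poly.ContainsRMonomial F r (Poly.P[_] F G k)
lemma2 F r k n _ G = mk⇔ to from
  where
  open Field F using (0≉1) renaming (sym to ≈-sym; trans to ≈-trans)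
  open Poly F

  to : HasRSimplePath G r k → ContainsRMonomial r (P[ G ] k)
  to (p , path , simple) =
    proj₁ (pathMon p) , Equivalence.from (rMonomial⇔rSimple F r p) simple ,
    proj₂ (pathMon p) , λ coeff≈0 → 0≉1 (≈-trans (≈-sym coeff≈0) (coeff-P-pathMon F G p path))

  from : ContainsRMonomial r (P[ G ] k) → HasRSimplePath G r k
  from (a , rmon , b , coeff≉0) with coeff-P≉0⇒pathMon F G {a , b} coeff≉0
  ... | p , path , refl = p , path , Equivalence.to (rMonomial⇔rSimple F r p) rmon
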